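{- Let $M=(m_i)_{i=0}^{\infty}$ be a sequence of integers with $m_0=1$ and $m_i\ge 2$ for $i\ge 1$, and let $M'=(1,m_2,m_3,\ldots)$. Let $k\in\mathbb{N}$. Then for every integer $n\ge \frac{km_1}{m_1-1}$, \[ a_M(n-k,n)=\sum_{\substack{j\in\mathbb{Z}\\ k/m_1\le j\le k/(m_1-1)}}a_{M'}(m_1j-k,j). \] In particular, if $n\ge km_1/(m_1-1)$ and $1\le k\le m_1-2$, then $a_M(n-k,n)=0$.
   Context: For a sequence $N=(n_i)_{i\ge0}$ of integers with $n_0=1$, $n_i\ge2$ for $i\ge1$, put $N_i=\prod_{j=0}^{i}n_j$; then $a_N(j,n)$ denotes the number of representations of $n$ as a sum of exactly $j$ numbers from $\{N_0,N_1,N_2,\ldots\}$ (order irrelevant, repetitions allowed), i.e. the coefficient of $t^j$ in $p_N(n,t)$, where $\prod_{i\ge0}\frac{1}{1-tq^{N_i}}=\sum_n p_N(n,t)q^n$. By convention $a_N(j,n)=0$ if $j<0$ or $j>n$. -}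

module Defs where

open import Data.Nat using (ℕ; zero; suc; _+_; _*_; _∸_; _≤_; _≤?_; _≟_)
open import Data.List using (List; []; _∷_; map; upTo)
open import Data.Nat.ListAction using (sum)
open import Data.Bool using (Bool; true; false; if_then_else_; _∧_)
open import Data.Product using (_×_)
open import Relation.Nullary.Decidable using (⌊_⌋)
open import Relation.Binary.PropositionalEquality using (_≡_)

Admissible : (ℕ → ℕ) → Set
Admissible m = (m 0 ≡ 1) × (∀ i → 2 ≤ m (suc i))

bigN : (ℕ → ℕ) → ℕ → ℕ
bigN m zero    = m 0
bigN m (suc i) = bigN m i * m (suc i)

-- cnt ps j n = number of multiplicity vectors (c_p)_{p ∈ ps} with
-- Σ c_p = j and Σ c_p * p = n  (i.e. representations of n as a sum of
-- exactly j parts taken from the list ps, order irrelevant, repetitions allowed).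
cnt : List ℕ → ℕ → ℕ → ℕ
cnt [] j n = if ⌊ j ≟ 0 ⌋ ∧ ⌊ n ≟ 0 ⌋ then 1 else 0
cnt (p ∷ ps) j n = sum (map (λ c → if ⌊ c * p ≤? n ⌋ then cnt ps (j ∸ c) (n ∸ c * p) else 0) (upTo (suc j)))

-- Only parts N_i with i ≤ n can occur (N_i ≥ 2^i > n
-- for i > n under admissibility), and for admissible N the N_i are pairwise
-- distinct, so we count multiplicity vectors over N_0, …, N_n.
a : (ℕ → ℕ) → ℕ → ℕ → ℕ
a m j n = cnt (map (bigN m) (upTo (suc n))) j n

shift : (ℕ → ℕ) → (ℕ → ℕ)
shift m zero    = 1
shift m (suc i) = m (suc (suc i))

-- Such j satisfy 0 ≤ j ≤ k (as m_1 ≥ 2), so we sum over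
-- j ∈ {0,…,k} subject to k ≤ m_1 j and (m_1 - 1) j ≤ k.
rhs : (ℕ → ℕ) → ℕ → ℕ
rhs m k = sum (map (λ j → if ⌊ k ≤? m 1 * j ⌋ ∧ ⌊ (m 1 ∸ 1) * j ≤? k ⌋
                            then a (shift m) (m 1 * j ∸ k) j else 0)
                   (upTo (suc k)))

-- In a representation of n by n − k parts from {1} ∪ m₁·{N'₀, N'₁, …}, let m₁ j be the sum
-- of the parts other than 1. There are n − m₁ j ones, hence m₁ j − k other parts, and dividing
-- them by m₁ gives a representation of j by m₁ j − k parts of M'. That count vanishes unless
-- m₁ j − k ≤ j, i.e. (m₁ − 1) j ≤ k, and together with k m₁ ≤ n (m₁ − 1) this already forces
-- m₁ j ≤ n, so the constraint coming from the ones disappears. For 1 ≤ k ≤ m₁ − 2 no j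
-- satisfies k ≤ m₁ j and (m₁ − 1) j ≤ k.
module Submission where

open import Defs
open import Data.Nat using (ℕ; zero; suc; _+_; _*_; _∸_; _≤_; _<_; _≤?_; _≟_; _≤′_; ≤′-reflexive; ≤′-step; z≤n; s≤s; s≤s⁻¹; z<s; NonZero)
open import Data.Nat.Properties
open import Data.Nat.Divisibility using (_∣_; _∣?_; divides; _∣0; ∣-trans; ∣m∸n∣n⇒∣m; m∣m*n; n∣m*n)
open import Data.Nat.ListAction using (sum)
open import Data.Nat.ListAction.Properties using (sum-++)
open import Data.List using ([]; _∷_; [_]; _++_; _∷ʳ_; map; upTo; applyUpTo)
open import Data.List.Properties using (map-++; map-cong; map-∘; map-upTo; map-applyUpTo; upTo-∷ʳ)
open import Data.List.Relation.Unary.All as All using (All; []; _∷_)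
open import Data.List.Relation.Unary.All.Properties using (map⁺; applyUpTo⁺₂)
open import Data.Bool using (if_then_else_; _∧_)
open import Data.Bool.Properties using (∧-zeroʳ)
open import Data.Product using (_×_; _,_)
open import Function using (id; _∘_; mk⇔)
open import Relation.Nullary using (¬_; Dec; yes; no; contradiction)
open import Relation.Nullary.Decidable using (⌊_⌋; isYes≗does; does-⇔)
open import Relation.Binary.PropositionalEquality
  using (_≡_; _≢_; refl; sym; trans; cong; cong₂; subst; _≗_; ≢-sym; module ≡-Reasoning)
open import Algebra.Properties.CommutativeSemigroup +-commutativeSemigroup using (interchange)
open import Algebra.Properties.CommutativeSemigroup *-commutativeSemigroup using ()
  renaming (x∙yz≈y∙xz to *-leftComm)

Lj≤k⇒[1+L]j≤n : ∀ L .{{_ : NonZero L}} {j k n} → L * j ≤ k → k * suc L ≤ n * L → suc L * j ≤ n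
Lj≤k⇒[1+L]j≤n L {j} {k} {n} Lj≤k kK≤nL = *-cancelˡ-≤ L (begin
  L * (suc L * j)  ≡⟨ *-leftComm L (suc L) j ⟩
  suc L * (L * j)  ≤⟨ *-monoʳ-≤ (suc L) Lj≤k ⟩
  suc L * k        ≡⟨ *-comm (suc L) k ⟩
  k * suc L        ≤⟨ kK≤nL ⟩
  n * L            ≡⟨ *-comm n L ⟩
  L * n            ∎)
  where open ≤-Reasoning

open ≡-Reasoning

private
  variable
    A B : Set
    x y : ℕ

⌊⌋-cong : (A → B) → (B → A) → (a? : Dec A) (b? : Dec B) → ⌊ a? ⌋ ≡ ⌊ b? ⌋
⌊⌋-cong A→B B→A a? b? =
  trans (isYes≗does a?) (trans (does-⇔ (mk⇔ A→B B→A) a? b?) (sym (isYes≗does b?)))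

if-yes : (a? : Dec A) → A → (if ⌊ a? ⌋ then x else y) ≡ x
if-yes (yes _) _ = refl
if-yes (no ¬a) a = contradiction a ¬a

if-no : (a? : Dec A) → ¬ A → (if ⌊ a? ⌋ then x else y) ≡ y
if-no (yes a) ¬a = contradiction a ¬a
if-no (no _)  _  = refl

if-∧-no : (a? : Dec A) (b? : Dec B) → ¬ (A × B) → (if ⌊ a? ⌋ ∧ ⌊ b? ⌋ then x else y) ≡ y
if-∧-no (no _)  _       _   = refl
if-∧-no (yes _) (no _)  _   = refl
if-∧-no (yes a) (yes b) ¬ab = contradiction (a , b) ¬ab

-- Both cnt (p ∷ ps) j n and rhs m k unfold definitionally to sums of this shape.
∑< : ℕ → (ℕ → ℕ) → ℕ
∑< n f = sum (map f (upTo n))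

syntax ∑< n (λ i → t) = ∑[ i < n ] t

∑<-head : ∀ n f → ∑< (suc n) f ≡ f 0 + ∑< n (f ∘ suc)
∑<-head n f = cong (λ xs → f 0 + sum xs)
  (trans (map-applyUpTo suc f n) (sym (map-upTo (f ∘ suc) n)))

∑<-last : ∀ n f → ∑< (suc n) f ≡ ∑< n f + f n
∑<-last n f = begin
  sum (map f (upTo (suc n)))       ≡⟨ cong (sum ∘ map f) (upTo-∷ʳ n) ⟨
  sum (map f (upTo n ∷ʳ n))        ≡⟨ cong sum (map-++ f (upTo n) [ n ]) ⟩
  sum (map f (upTo n) ++ [ f n ])  ≡⟨ sum-++ (map f (upTo n)) [ f n ] ⟩
  ∑< n f + (f n + 0)               ≡⟨ cong (∑< n f +_) (+-identityʳ (f n)) ⟩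
  ∑< n f + f n                     ∎

∑<-cong : ∀ n {f g : ℕ → ℕ} → f ≗ g → ∑< n f ≡ ∑< n g
∑<-cong n f≗g = cong sum (map-cong f≗g (upTo n))

∑<-zero : ∀ n {f} → (∀ i → i < n → f i ≡ 0) → ∑< n f ≡ 0
∑<-zero zero    _      = refl
∑<-zero (suc n) {f} f≡0 = begin
  ∑< (suc n) f  ≡⟨ ∑<-last n f ⟩
  ∑< n f + f n  ≡⟨ cong₂ _+_ (∑<-zero n (λ i i<n → f≡0 i (m<n⇒m<1+n i<n))) (f≡0 n ≤-refl) ⟩
  0             ∎

∑<-single : ∀ n {f} i → i < n → (∀ j → j ≢ i → f j ≡ 0) → ∑< n f ≡ f i
∑<-single (suc n) {f} i i<1+n f≡0 with i ≟ n
... | yes refl = begin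
  ∑< (suc i) f  ≡⟨ ∑<-last i f ⟩
  ∑< i f + f i  ≡⟨ cong (_+ f i) (∑<-zero i (λ j j<i → f≡0 j (<⇒≢ j<i))) ⟩
  f i           ∎
... | no i≢n = begin
  ∑< (suc n) f  ≡⟨ ∑<-last n f ⟩
  ∑< n f + f n  ≡⟨ cong₂ _+_ (∑<-single n i (≤∧≢⇒< (s≤s⁻¹ i<1+n) i≢n) f≡0) (f≡0 n (≢-sym i≢n)) ⟩
  f i + 0       ≡⟨ +-identityʳ (f i) ⟩
  f i           ∎

∑<-distrib-+ : ∀ n f g → ∑[ i < n ] (f i + g i) ≡ ∑< n f + ∑< n g
∑<-distrib-+ zero    f g = refl
∑<-distrib-+ (suc n) f g = begin
  ∑[ i < suc n ] (f i + g i)              ≡⟨ ∑<-last n _ ⟩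
  ∑[ i < n ] (f i + g i) + (f n + g n)    ≡⟨ cong (_+ (f n + g n)) (∑<-distrib-+ n f g) ⟩
  (∑< n f + ∑< n g) + (f n + g n)         ≡⟨ interchange (∑< n f) (∑< n g) (f n) (g n) ⟩
  (∑< n f + f n) + (∑< n g + g n)         ≡⟨ cong₂ _+_ (∑<-last n f) (∑<-last n g) ⟨
  ∑< (suc n) f + ∑< (suc n) g             ∎

∑<-comm : ∀ m n (f : ℕ → ℕ → ℕ) → ∑[ i < m ] ∑[ j < n ] f i j ≡ ∑[ j < n ] ∑[ i < m ] f i j
∑<-comm zero    n f = sym (∑<-zero n (λ _ _ → refl))
∑<-comm (suc m) n f = begin
  ∑[ i < suc m ] ∑[ j < n ] f i j                     ≡⟨ ∑<-last m _ ⟩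
  ∑[ i < m ] ∑[ j < n ] f i j + ∑[ j < n ] f m j      ≡⟨ cong (_+ ∑< n (f m)) (∑<-comm m n f) ⟩
  ∑[ j < n ] ∑[ i < m ] f i j + ∑[ j < n ] f m j      ≡⟨ ∑<-distrib-+ n _ (f m) ⟨
  ∑[ j < n ] (∑[ i < m ] f i j + f m j)               ≡⟨ ∑<-cong n (λ j → ∑<-last m (λ i → f i j)) ⟨
  ∑[ j < n ] ∑[ i < suc m ] f i j                     ∎

∑<-if-≡-+ : ∀ d k x y →
  ∑[ e < suc d ] (if ⌊ x ≟ k + e ⌋ then y else 0) ≡ (if ⌊ k ≤? x ⌋ ∧ ⌊ x ≤? k + d ⌋ then y else 0)
∑<-if-≡-+ d k x y with k ≤? x | x ≤? k + d
... | no k≰x | _ = ∑<-zero (suc d) (λ e _ → if-no (x ≟ k + e)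
        (λ x≡k+e → k≰x (subst (k ≤_) (sym x≡k+e) (m≤m+n k e))))
... | yes _ | no x≰k+d = ∑<-zero (suc d) (λ e e<1+d → if-no (x ≟ k + e)
        (λ x≡k+e → x≰k+d (subst (_≤ k + d) (sym x≡k+e) (+-monoʳ-≤ k (s≤s⁻¹ e<1+d)))))
... | yes k≤x | yes x≤k+d = trans (∑<-single (suc d) (x ∸ k) (s≤s x∸k≤d) off-diagonal)
                                   (if-yes (x ≟ k + (x ∸ k)) (sym (m+[n∸m]≡n k≤x)))
  where
  x∸k≤d : x ∸ k ≤ d
  x∸k≤d = subst (x ∸ k ≤_) (m+n∸m≡n k d) (∸-monoˡ-≤ k x≤k+d)
  off-diagonal : ∀ e → e ≢ x ∸ k → (if ⌊ x ≟ k + e ⌋ then y else 0) ≡ 0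
  off-diagonal e e≢x∸k = if-no (x ≟ k + e)
    (λ x≡k+e → e≢x∸k (trans (sym (m+n∸m≡n k e)) (cong (_∸ k) (sym x≡k+e))))

cnt-1∷-suc : ∀ ps j n → cnt (1 ∷ ps) (suc j) (suc n) ≡ cnt ps (suc j) (suc n) + cnt (1 ∷ ps) j n
cnt-1∷-suc ps j n =
  trans (∑<-head (suc j) (λ c → if ⌊ c * 1 ≤? suc n ⌋ then cnt ps (suc j ∸ c) (suc n ∸ c * 1) else 0))
        (cong (cnt ps (suc j) (suc n) +_) (∑<-cong (suc j) drop-a-one))
  where
  drop-a-one : ∀ c → (if ⌊ suc c * 1 ≤? suc n ⌋ then cnt ps (j ∸ c) (n ∸ c * 1) else 0)
                   ≡ (if ⌊ c * 1 ≤? n ⌋ then cnt ps (j ∸ c) (n ∸ c * 1) else 0)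
  drop-a-one c = cong (λ b → if b then cnt ps (j ∸ c) (n ∸ c * 1) else 0)
    (⌊⌋-cong s≤s⁻¹ s≤s (suc c * 1 ≤? suc n) (c * 1 ≤? n))

cnt-1∷ : ∀ ps k d → cnt (1 ∷ ps) d (k + d) ≡ ∑[ e < suc d ] cnt ps e (k + e)
cnt-1∷ ps k zero    = refl
cnt-1∷ ps k (suc d) = begin
  cnt (1 ∷ ps) (suc d) (k + suc d)
    ≡⟨ cong (cnt (1 ∷ ps) (suc d)) (+-suc k d) ⟩
  cnt (1 ∷ ps) (suc d) (suc (k + d))
    ≡⟨ cnt-1∷-suc ps d (k + d) ⟩
  cnt ps (suc d) (suc (k + d)) + cnt (1 ∷ ps) d (k + d)
    ≡⟨ cong₂ _+_ (cong (cnt ps (suc d)) (sym (+-suc k d))) (cnt-1∷ ps k d) ⟩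
  cnt ps (suc d) (k + suc d) + ∑[ e < suc d ] cnt ps e (k + e)
    ≡⟨ +-comm (cnt ps (suc d) (k + suc d)) _ ⟩
  ∑[ e < suc d ] cnt ps e (k + e) + cnt ps (suc d) (k + suc d)
    ≡⟨ ∑<-last (suc d) (λ e → cnt ps e (k + e)) ⟨
  ∑[ e < suc (suc d) ] cnt ps e (k + e)
    ∎

total<parts⇒cnt≡0 : ∀ qs → All (1 ≤_) qs → ∀ {j n} → n < j → cnt qs j n ≡ 0
total<parts⇒cnt≡0 []       _             {suc j} _   = refl
total<parts⇒cnt≡0 (q ∷ qs) (1≤q ∷ qs≥1) {j} {n} n<j = ∑<-zero (suc j) vanish
  where
  vanish : ∀ c → c < suc j → (if ⌊ c * q ≤? n ⌋ then cnt qs (j ∸ c) (n ∸ c * q) else 0) ≡ 0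
  vanish c _ with c * q ≤? n
  ... | no _     = refl
  ... | yes cq≤n = total<parts⇒cnt≡0 qs qs≥1
    (≤-<-trans (∸-monoʳ-≤ n c≤cq) (∸-monoˡ-< n<j (≤-trans c≤cq cq≤n)))
    where
    c≤cq : c ≤ c * q
    c≤cq = subst (_≤ c * q) (*-identityʳ c) (*-monoʳ-≤ c 1≤q)

cnt-++-parts> : ∀ xs ys j n → All (n <_) ys → cnt (xs ++ ys) j n ≡ cnt xs j n
cnt-++-parts> []       []       j n _                = refl
cnt-++-parts> []       (y ∷ ys) j n (n<y ∷ ys>n) = begin
  cnt (y ∷ ys) j n      ≡⟨ ∑<-head j _ ⟩
  cnt ys j n + ∑< j _   ≡⟨ cong (cnt ys j n +_) (∑<-zero j (λ c _ → if-no (suc c * y ≤? n)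
                             (λ le → <⇒≱ n<y (≤-trans (m≤m+n y (c * y)) le)))) ⟩
  cnt ys j n + 0        ≡⟨ +-identityʳ _ ⟩
  cnt ys j n            ≡⟨ cnt-++-parts> [] ys j n ys>n ⟩
  cnt [] j n            ∎
cnt-++-parts> (x ∷ xs) ys j n ys>n = ∑<-cong (suc j) (λ c →
  cong (λ t → if ⌊ c * x ≤? n ⌋ then t else 0)
       (cnt-++-parts> xs ys (j ∸ c) (n ∸ c * x) (All.map (≤-<-trans (m∸n≤m n (c * x))) ys>n)))

cnt-map-upTo-≥ : ∀ q → (∀ i → i < q i) → ∀ r {j t} → j ≤ t →
  cnt (map q (upTo t)) r j ≡ cnt (map q (upTo j)) r j
cnt-map-upTo-≥ q q> r {j} j≤t = drop-tail (≤⇒≤′ j≤t)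
  where
  drop-tail : ∀ {t} → j ≤′ t → cnt (map q (upTo t)) r j ≡ cnt (map q (upTo j)) r j
  drop-tail (≤′-reflexive refl) = refl
  drop-tail (≤′-step {t} j≤′t) = begin
    cnt (map q (upTo (suc t))) r j           ≡⟨ cong (λ xs → cnt (map q xs) r j) (upTo-∷ʳ t) ⟨
    cnt (map q (upTo t ∷ʳ t)) r j            ≡⟨ cong (λ xs → cnt xs r j) (map-++ q (upTo t) [ t ]) ⟩
    cnt (map q (upTo t) ++ [ q t ]) r j      ≡⟨ cnt-++-parts> (map q (upTo t)) [ q t ] r j
                                                  (≤-<-trans (≤′⇒≤ j≤′t) (q> t) ∷ []) ⟩
    cnt (map q (upTo t)) r j                 ≡⟨ drop-tail j≤′t ⟩
    cnt (map q (upTo j)) r j                 ∎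

cnt-map-* : ∀ K .{{_ : NonZero K}} qs r n → cnt (map (K *_) qs) r (K * n) ≡ cnt qs r n
cnt-map-* K []       r n = cong (λ b → if ⌊ r ≟ 0 ⌋ ∧ b then 1 else 0)
  (⌊⌋-cong (λ Kn≡0 → *-cancelˡ-≡ n 0 K (trans Kn≡0 (sym (*-zeroʳ K))))
           (λ n≡0 → trans (cong (K *_) n≡0) (*-zeroʳ K))
           (K * n ≟ 0) (n ≟ 0))
cnt-map-* K (q ∷ qs) r n = ∑<-cong (suc r) scaled
  where
  Kqs = map (K *_) qs
  scaled : ∀ c → (if ⌊ c * (K * q) ≤? K * n ⌋ then cnt Kqs (r ∸ c) (K * n ∸ c * (K * q)) else 0)
               ≡ (if ⌊ c * q ≤? n ⌋ then cnt qs (r ∸ c) (n ∸ c * q) else 0)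
  scaled c = begin
    (if ⌊ c * (K * q) ≤? K * n ⌋ then cnt Kqs (r ∸ c) (K * n ∸ c * (K * q)) else 0)
      ≡⟨ cong (λ s → if ⌊ s ≤? K * n ⌋ then cnt Kqs (r ∸ c) (K * n ∸ s) else 0) (*-leftComm c K q) ⟩
    (if ⌊ K * (c * q) ≤? K * n ⌋ then cnt Kqs (r ∸ c) (K * n ∸ K * (c * q)) else 0)
      ≡⟨ cong (λ b → if b then cnt Kqs (r ∸ c) (K * n ∸ K * (c * q)) else 0)
              (⌊⌋-cong (*-cancelˡ-≤ K) (*-monoʳ-≤ K) (K * (c * q) ≤? K * n) (c * q ≤? n)) ⟩
    (if ⌊ c * q ≤? n ⌋ then cnt Kqs (r ∸ c) (K * n ∸ K * (c * q)) else 0)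
      ≡⟨ cong (λ t → if ⌊ c * q ≤? n ⌋ then t else 0)
              (trans (cong (cnt Kqs (r ∸ c)) (sym (*-distribˡ-∸ K n (c * q))))
                     (cnt-map-* K qs (r ∸ c) (n ∸ c * q))) ⟩
    (if ⌊ c * q ≤? n ⌋ then cnt qs (r ∸ c) (n ∸ c * q) else 0)
      ∎

∤⇒cnt-map-*≡0 : ∀ K qs r {n} → ¬ K ∣ n → cnt (map (K *_) qs) r n ≡ 0
∤⇒cnt-map-*≡0 K []       r {zero}  K∤0 = contradiction (K ∣0) K∤0
∤⇒cnt-map-*≡0 K []       r {suc n} _   = cong (λ b → if b then 1 else 0) (∧-zeroʳ ⌊ r ≟ 0 ⌋)
∤⇒cnt-map-*≡0 K (q ∷ qs) r {n} K∤n = ∑<-zero (suc r) vanish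
  where
  vanish : ∀ c → c < suc r →
    (if ⌊ c * (K * q) ≤? n ⌋ then cnt (map (K *_) qs) (r ∸ c) (n ∸ c * (K * q)) else 0) ≡ 0
  vanish c _ with c * (K * q) ≤? n
  ... | no _    = refl
  ... | yes ≤n  = ∤⇒cnt-map-*≡0 K qs (r ∸ c)
    (λ K∣n∸ → K∤n (∣m∸n∣n⇒∣m K ≤n K∣n∸ (∣-trans (m∣m*n q) (n∣m*n c))))

-- k + e = K j₀ with j₀ > k forces j₀ < e, so that case contributes nothing on either side.
cnt-map-*-fibres : ∀ K → 2 ≤ K → ∀ qs → All (1 ≤_) qs → ∀ k e →
  cnt (map (K *_) qs) e (k + e) ≡
  ∑[ j < suc k ] (if ⌊ K * j ≟ k + e ⌋ then cnt qs (K * j ∸ k) j else 0)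
cnt-map-*-fibres (suc (suc K')) (s≤s (s≤s z≤n)) qs qs≥1 k e with suc (suc K') ∣? (k + e)
... | no K∤k+e = trans (∤⇒cnt-map-*≡0 K qs e K∤k+e) (sym (∑<-zero (suc k) (λ j _ →
        if-no (K * j ≟ k + e) (λ Kj≡k+e → K∤k+e (divides j (trans (sym Kj≡k+e) (*-comm K j)))))))
  where K = suc (suc K')
... | yes (divides j₀ k+e≡j₀K) = begin
  cnt (map (K *_) qs) e (k + e)   ≡⟨ cong (cnt (map (K *_) qs) e) k+e≡Kj₀ ⟩
  cnt (map (K *_) qs) e (K * j₀)  ≡⟨ cnt-map-* K qs e j₀ ⟩
  cnt qs e j₀                     ≡⟨ fibre-of-j₀ ⟩
  ∑[ j < suc k ] term j           ∎
  where
  K = suc (suc K')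
  term : ℕ → ℕ
  term j = if ⌊ K * j ≟ k + e ⌋ then cnt qs (K * j ∸ k) j else 0
  k+e≡Kj₀ : k + e ≡ K * j₀
  k+e≡Kj₀ = trans k+e≡j₀K (*-comm j₀ K)
  off-fibre : ∀ j → j ≢ j₀ → term j ≡ 0
  off-fibre j j≢j₀ = if-no (K * j ≟ k + e) (λ Kj≡k+e → j≢j₀ (*-cancelˡ-≡ j j₀ K (trans Kj≡k+e k+e≡Kj₀)))
  fibre-of-j₀ : cnt qs e j₀ ≡ ∑[ j < suc k ] term j
  fibre-of-j₀ with j₀ ≤? k
  ... | yes j₀≤k = begin
    cnt qs e j₀                ≡⟨ cong (λ r → cnt qs r j₀) (m+n∸m≡n k e) ⟨
    cnt qs (k + e ∸ k) j₀      ≡⟨ cong (λ s → cnt qs (s ∸ k) j₀) k+e≡Kj₀ ⟩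
    cnt qs (K * j₀ ∸ k) j₀     ≡⟨ if-yes (K * j₀ ≟ k + e) (sym k+e≡Kj₀) ⟨
    term j₀                    ≡⟨ ∑<-single (suc k) j₀ (s≤s j₀≤k) off-fibre ⟨
    ∑[ j < suc k ] term j      ∎
  ... | no j₀≰k = trans (total<parts⇒cnt≡0 qs qs≥1 j₀<e)
      (sym (∑<-zero (suc k) (λ j j<1+k → off-fibre j (<⇒≢ (≤-<-trans (s≤s⁻¹ j<1+k) k<j₀)))))
    where
    k<j₀ : k < j₀
    k<j₀ = ≰⇒> j₀≰k
    j₀<e : j₀ < e
    j₀<e = +-cancelˡ-< k j₀ e (<-≤-trans (+-monoˡ-< j₀ k<j₀)
             (subst (j₀ + j₀ ≤_) (sym k+e≡Kj₀) (+-monoʳ-≤ j₀ (m≤m+n j₀ (K' * j₀)))))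

cnt-1∷map-* : ∀ K → 2 ≤ K → ∀ qs → All (1 ≤_) qs → ∀ k d →
  cnt (1 ∷ map (K *_) qs) d (k + d) ≡
  ∑[ j < suc k ] (if ⌊ k ≤? K * j ⌋ ∧ ⌊ K * j ≤? k + d ⌋ then cnt qs (K * j ∸ k) j else 0)
cnt-1∷map-* K 2≤K qs qs≥1 k d = begin
  cnt (1 ∷ map (K *_) qs) d (k + d)
    ≡⟨ cnt-1∷ (map (K *_) qs) k d ⟩
  ∑[ e < suc d ] cnt (map (K *_) qs) e (k + e)
    ≡⟨ ∑<-cong (suc d) (cnt-map-*-fibres K 2≤K qs qs≥1 k) ⟩
  ∑[ e < suc d ] ∑[ j < suc k ] (if ⌊ K * j ≟ k + e ⌋ then G j else 0)
    ≡⟨ ∑<-comm (suc d) (suc k) (λ e j → if ⌊ K * j ≟ k + e ⌋ then G j else 0) ⟩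
  ∑[ j < suc k ] ∑[ e < suc d ] (if ⌊ K * j ≟ k + e ⌋ then G j else 0)
    ≡⟨ ∑<-cong (suc k) (λ j → ∑<-if-≡-+ d k (K * j) (G j)) ⟩
  ∑[ j < suc k ] (if ⌊ k ≤? K * j ⌋ ∧ ⌊ K * j ≤? k + d ⌋ then G j else 0)
    ∎
  where
  G : ℕ → ℕ
  G j = cnt qs (K * j ∸ k) j

map-upTo-parts≥1 : ∀ {q} → (∀ i → i < q i) → ∀ n → All (1 ≤_) (map q (upTo n))
map-upTo-parts≥1 q> n = map⁺ (applyUpTo⁺₂ id n (λ i → ≤-<-trans z≤n (q> i)))

-- Under k K ≤ n (K − 1), the bound K j ≤ n is implied by (K − 1) j ≤ k, and when
-- (K − 1) j > k the summand vanishes anyway because K j − k > j.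
window : ∀ K → 2 ≤ K → ∀ q → (∀ i → i < q i) → ∀ k n → k * K ≤ n * (K ∸ 1) → ∀ j →
  (if ⌊ k ≤? K * j ⌋ ∧ ⌊ K * j ≤? n ⌋ then cnt (map q (upTo n)) (K * j ∸ k) j else 0) ≡
  (if ⌊ k ≤? K * j ⌋ ∧ ⌊ (K ∸ 1) * j ≤? k ⌋ then cnt (map q (upTo (suc j))) (K * j ∸ k) j else 0)
window K@(suc (suc K')) (s≤s (s≤s z≤n)) q q> k n kK≤n[K-1] j with k ≤? K * j
... | no _ = refl
... | yes _ with suc K' * j ≤? k
...   | yes [K-1]j≤k = begin
  (if ⌊ K * j ≤? n ⌋ then cnt (map q (upTo n)) (K * j ∸ k) j else 0)
    ≡⟨ if-yes (K * j ≤? n) Kj≤n ⟩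
  cnt (map q (upTo n)) (K * j ∸ k) j
    ≡⟨ cnt-map-upTo-≥ q q> (K * j ∸ k) (≤-trans (m≤n*m j K) Kj≤n) ⟩
  cnt (map q (upTo j)) (K * j ∸ k) j
    ≡⟨ cnt-map-upTo-≥ q q> (K * j ∸ k) (n≤1+n j) ⟨
  cnt (map q (upTo (suc j))) (K * j ∸ k) j
    ∎
  where
  Kj≤n : K * j ≤ n
  Kj≤n = Lj≤k⇒[1+L]j≤n (suc K') [K-1]j≤k kK≤n[K-1]
...   | no [K-1]j≰k with K * j ≤? n
...     | no _  = refl
...     | yes _ = total<parts⇒cnt≡0 (map q (upTo n)) (map-upTo-parts≥1 q> n) j<Kj∸k
  where
  j<Kj∸k : j < K * j ∸ k
  j<Kj∸k = subst (_< K * j ∸ k) (m+n∸n≡m j k)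
    (∸-monoˡ-< (+-monoʳ-< j (≰⇒> [K-1]j≰k)) (m≤n+m k j))

cnt-1∷map-*-upTo : ∀ K → 2 ≤ K → ∀ q → (∀ i → i < q i) → ∀ k n → k * K ≤ n * (K ∸ 1) →
  cnt (1 ∷ map (K *_) (map q (upTo n))) (n ∸ k) n ≡
  ∑[ j < suc k ] (if ⌊ k ≤? K * j ⌋ ∧ ⌊ (K ∸ 1) * j ≤? k ⌋
                    then cnt (map q (upTo (suc j))) (K * j ∸ k) j else 0)
cnt-1∷map-*-upTo K@(suc (suc K')) 2≤K@(s≤s (s≤s z≤n)) q q> k n kK≤n[K-1]
  with d , refl ← m≤n⇒∃[o]m+o≡n (*-cancelʳ-≤ k n K (≤-trans kK≤n[K-1] (*-monoʳ-≤ n (n≤1+n (suc K')))))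
  rewrite m+n∸m≡n k d
  = trans (cnt-1∷map-* K 2≤K (map q (upTo (k + d))) (map-upTo-parts≥1 q> (k + d)) k d)
          (∑<-cong (suc k) (window K 2≤K q q> k (k + d) kK≤n[K-1]))

no-window : ∀ K → 2 ≤ K → ∀ {k} → 1 ≤ k → k ≤ K ∸ 2 → ∀ j → ¬ (k ≤ K * j × (K ∸ 1) * j ≤ k)
no-window K _ {k} 1≤k _ zero (k≤K*0 , _) = <⇒≱ 1≤k (subst (k ≤_) (*-zeroʳ K) k≤K*0)
no-window (suc (suc K')) (s≤s (s≤s z≤n)) _ k≤K' (suc j) (_ , [K-1]j≤k) =
  <⇒≱ (s≤s k≤K') (≤-trans (m≤m*n (suc K') (suc j)) [K-1]j≤k)

bigN-suc : ∀ {m} → m 0 ≡ 1 → ∀ i → bigN m (suc i) ≡ m 1 * bigN (shift m) i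
bigN-suc {m} m₀≡1 zero = trans (cong (_* m 1) m₀≡1) (trans (*-identityˡ (m 1)) (sym (*-identityʳ (m 1))))
bigN-suc {m} m₀≡1 (suc i) =
  trans (cong (_* m (2 + i)) (bigN-suc m₀≡1 i)) (*-assoc (m 1) (bigN (shift m) i) (m (2 + i)))

map-bigN-upTo : ∀ {m} → m 0 ≡ 1 → ∀ n →
  map (bigN m) (upTo (suc n)) ≡ 1 ∷ map (m 1 *_) (map (bigN (shift m)) (upTo n))
map-bigN-upTo {m} m₀≡1 n = cong₂ _∷_ m₀≡1 (begin
  map (bigN m) (applyUpTo suc n)          ≡⟨ map-applyUpTo suc (bigN m) n ⟩
  applyUpTo (bigN m ∘ suc) n              ≡⟨ map-upTo (bigN m ∘ suc) n ⟨
  map (bigN m ∘ suc) (upTo n)             ≡⟨ map-cong (bigN-suc m₀≡1) (upTo n) ⟩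
  map ((m 1 *_) ∘ bigN (shift m)) (upTo n) ≡⟨ map-∘ (upTo n) ⟩
  map (m 1 *_) (map (bigN (shift m)) (upTo n)) ∎)

i<bigN : ∀ {m} → Admissible m → ∀ i → i < bigN m i
i<bigN (m₀≡1 , _)   zero    = subst (0 <_) (sym m₀≡1) z<s
i<bigN adm@(_ , m≥2) (suc i) = ≤-trans (s≤s (s≤s (m≤m*n i 2))) (*-mono-≤ (i<bigN adm i) (m≥2 i))

theorem6p8 : (m : ℕ → ℕ) → Admissible m → (k : ℕ) →
    ((n : ℕ) → k * m 1 ≤ n * (m 1 ∸ 1) → a m (n ∸ k) n ≡ rhs m k)
    × ((n : ℕ) → k * m 1 ≤ n * (m 1 ∸ 1) → 1 ≤ k → k ≤ m 1 ∸ 2 → a m (n ∸ k) n ≡ 0)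
theorem6p8 m (m₀≡1 , m≥2) k = count , vanish
  where
  count : (n : ℕ) → k * m 1 ≤ n * (m 1 ∸ 1) → a m (n ∸ k) n ≡ rhs m k
  count n hyp = begin
    a m (n ∸ k) n
      ≡⟨ cong (λ ps → cnt ps (n ∸ k) n) (map-bigN-upTo m₀≡1 n) ⟩
    cnt (1 ∷ map (m 1 *_) (map (bigN (shift m)) (upTo n))) (n ∸ k) n
      ≡⟨ cnt-1∷map-*-upTo (m 1) (m≥2 0) (bigN (shift m)) (i<bigN (refl , m≥2 ∘ suc)) k n hyp ⟩
    rhs m k
      ∎
  vanish : (n : ℕ) → k * m 1 ≤ n * (m 1 ∸ 1) → 1 ≤ k → k ≤ m 1 ∸ 2 → a m (n ∸ k) n ≡ 0
  vanish n hyp 1≤k k≤m₁∸2 = trans (count n hyp) (∑<-zero (suc k) (λ j _ →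
    if-∧-no (k ≤? m 1 * j) ((m 1 ∸ 1) * j ≤? k) (no-window (m 1) (m≥2 0) 1≤k k≤m₁∸2 j)))
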